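{- Let $X=(D;\sim,\lambda)$ be a connected graph and let $\xi\colon D\to A$ be a harmonic flow on $X$ with values in an abelian group $A$. Let $f\in\mathrm{Aut}(X)$ satisfy $\xi(f(x))=\xi(x)$ for all $x\in D$, and assume $\langle f\rangle$ acts semiregularly both on darts and on vertices of $X$. Let $Y=X/\langle f\rangle$ and $\varphi\colon X\to Y$, $x\mapsto[x]_f$, the canonical projection. Then $\bar\xi\colon D(Y)\to A$ defined by $\bar\xi([x]_f)=\xi(x)$ is a flow on $Y$ satisfying $\sum_{\bar y\sim\bar x}\bar\xi(\bar y)=0$ for every dart $\bar x$ of $Y$, and the local group $A^{\bar\xi}$ is an epimorphic image of $\langle f\rangle$.
   Context: A graph is a triple $(D;\sim,\lambda)$: $D$ a finite nonempty set of darts, $\sim$ an equivalence on $D$ whose classes are vertices, $\lambda$ an involution on $D$ (write $x^{ -1}=\lambda(x)$) whose orbits are edges (loops, parallel edges and semiedges $x=x^{ -1}$ allowed); $I(x)$ is the class of $x$. An automorphism is a permutation $f$ of $D$ with $x\sim y\Rightarrow f(x)\sim f(y)$ and $\lambda f=f\lambda$. The quotient $X/\langle f\rangle$ has as darts the $\langle f\rangle$-orbits $[x]_f$, with $[x]_f\sim[y]_f$ iff some representatives are $\sim$-equivalent, and $\lambda([x]_f)=[x^{ -1}]_f$. An oriented cycle is a sequence of darts $x_0,\dots,x_{m-1}$ with $I(x_i)=I(x_{i-1}^{ -1})$, $I(x_0)=I(x_{m-1}^{ -1})$ and pairwise distinct $I(x_i)$ (a single semiedge dart is a cycle). For an abelian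 group $A$, an $A$-flow is a map $\nu\colon D\to A$ with $\nu(x^{ -1})=-\nu(x)$ whose values generate $A$; it is harmonic if $\sum_{y\sim x}\nu(y)=0$ for every dart $x$ and $\sum_i\nu(x_i)=0$ for every oriented cycle. The local group $A^{\nu}$ of a flow $\nu$ is the subgroup of $A$ generated by all cycle sums $\nu(C)=\sum_{i}\nu(x_i)$, $C=(x_0,\dots,x_{m-1})$ an oriented cycle. -}

module Defs where

open import Level using (Level; _⊔_; 0ℓ)
open import Data.Nat using (ℕ; zero; suc; _+_)
open import Data.Fin using (Fin; zero; suc; inject₁; fromℕ)
open import Data.Product using (Σ; ∃; _×_; _,_)
open import Data.Sum using (_⊎_)
open import Relation.Nullary using (Dec; yes; no)
open import Relation.Binary using (IsEquivalence; Decidable)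
open import Relation.Binary.PropositionalEquality using (_≡_)
open import Relation.Binary.Construct.Closure.ReflexiveTransitive using (Star)
open import Function.Definitions using (Bijective)
open import Algebra.Bundles using (AbelianGroup)

iter : ∀ {a} {A : Set a} → (A → A) → ℕ → A → A
iter f zero x = x
iter f (suc k) x = f (iter f k x)

-- A graph (D ; ∼ , λ) with D = Fin (suc n) (finite, nonempty).
-- ∼ is a (decidable) equivalence whose classes are the vertices,
-- inv is the involution λ (x⁻¹ = inv x).
record Graph : Set₁ where
  field
    n      : ℕ
    _∼_    : Fin (suc n) → Fin (suc n) → Set
    ∼-equiv : IsEquivalence _∼_
    ∼-dec  : Decidable _∼_
    inv    : Fin (suc n) → Fin (suc n)
    inv-invol : ∀ x → inv (inv x) ≡ x

  Dart : Set
  Dart = Fin (suc n)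

open Graph public

data Step (X : Graph) (x y : Dart X) : Set where
  same  : _∼_ X x y → Step X x y
  cross : y ≡ inv X x → Step X x y

Connected : Graph → Set
Connected X = ∀ (x y : Dart X) → Star (Step X) x y

record IsAutomorphism (X : Graph) (f : Dart X → Dart X) : Set where
  field
    bij      : Bijective _≡_ _≡_ f
    pres-∼   : ∀ {x y} → _∼_ X x y → _∼_ X (f x) (f y)
    comm-inv : ∀ x → inv X (f x) ≡ f (inv X x)

SemiregularOnDarts : (X : Graph) → (Dart X → Dart X) → Set
SemiregularOnDarts X f = ∀ k x → iter f k x ≡ x → ∀ y → iter f k y ≡ y

SemiregularOnVertices : (X : Graph) → (Dart X → Dart X) → Set
SemiregularOnVertices X f = ∀ k x → _∼_ X (iter f k x) x → ∀ y → iter f k y ≡ y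

-- Y = X/⟨f⟩ with canonical projection φ (characterised up to isomorphism):
-- darts of Y are the ⟨f⟩-orbits, [x]∼[y] iff some representatives are ∼,
-- and λ([x]) = [x⁻¹].
record IsQuotientBy (X : Graph) (f : Dart X → Dart X) (Y : Graph)
                    (φ : Dart X → Dart Y) : Set where
  field
    surj     : ∀ (y : Dart Y) → ∃ λ x → φ x ≡ y
    orbit⇒   : ∀ x y → φ x ≡ φ y → ∃ λ k → iter f k x ≡ y
    ⇐orbit   : ∀ x y k → iter f k x ≡ y → φ x ≡ φ y
    vtx⇒     : ∀ x y → _∼_ Y (φ x) (φ y) →
                 Σ (Dart X) λ x' → Σ (Dart X) λ y' →
                   φ x' ≡ φ x × φ y' ≡ φ y × _∼_ X x' y'
    ⇐vtx     : ∀ x y → _∼_ X x y → _∼_ Y (φ x) (φ y)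
    inv-comm : ∀ x → inv Y (φ x) ≡ φ (inv X x)

record OrientedCycle (X : Graph) : Set where
  field
    k        : ℕ
    dart     : Fin (suc k) → Dart X
    linked   : ∀ (i : Fin k) → _∼_ X (dart (suc i)) (inv X (dart (inject₁ i)))
    closed   : _∼_ X (dart zero) (inv X (dart (fromℕ k)))
    distinct : ∀ i j → _∼_ X (dart i) (dart j) → i ≡ j

module _ {c ℓ} (A : AbelianGroup c ℓ) where
  open AbelianGroup A

  data Gen {p} (S : Carrier → Set p) : Carrier → Set (c ⊔ ℓ ⊔ p) where
    gen  : ∀ {a b} → S a → b ≈ a → Gen S b
    unit : ∀ {b} → b ≈ ε → Gen S b
    ginv : ∀ {a b} → Gen S a → b ≈ a ⁻¹ → Gen S b
    gmul : ∀ {a a' b} → Gen S a → Gen S a' → b ≈ a ∙ a' → Gen S b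

  sumFin : (m : ℕ) → (Fin m → Carrier) → Carrier
  sumFin zero g = ε
  sumFin (suc m) g = g zero ∙ sumFin m (λ i → g (suc i))

  select : ∀ {p} {P : Set p} → Dec P → Carrier → Carrier
  select (yes _) a = a
  select (no _) a = ε

  module _ (X : Graph) (ν : Dart X → Carrier) where
    vertexSum : Dart X → Carrier
    vertexSum x = sumFin (suc (n X)) (λ y → select (∼-dec X y x) (ν y))

    cycleSum : OrientedCycle X → Carrier
    cycleSum C = sumFin (suc (OrientedCycle.k C)) (λ i → ν (OrientedCycle.dart C i))

    record IsFlow : Set (c ⊔ ℓ) where
      field
        antisym   : ∀ x → ν (inv X x) ≈ ν x ⁻¹
        generates : ∀ a → Gen (λ b → ∃ λ x → ν x ≈ b) a

    record IsHarmonic : Set (c ⊔ ℓ) where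
      field
        flow       : IsFlow
        vertexZero : ∀ x → vertexSum x ≈ ε
        cycleZero  : ∀ C → cycleSum C ≈ ε

    InLocalGroup : Carrier → Set (c ⊔ ℓ)
    InLocalGroup = Gen (λ a → Σ (OrientedCycle X) λ C → cycleSum C ≈ a)

  -- the local group A^ν (of a flow on Y) is an epimorphic image of ⟨f⟩ (f a
  -- permutation of the darts of X): a homomorphism h : ⟨f⟩ → A, f^k ↦ h k,
  -- with image exactly A^ν.
  EpiImageOfCyclic : (X : Graph) (f : Dart X → Dart X)
                     (Y : Graph) (ν : Dart Y → Carrier) → Set (c ⊔ ℓ)
  EpiImageOfCyclic X f Y ν =
    Σ (ℕ → Carrier) λ h →
      (∀ i j → (∀ x → iter f i x ≡ iter f j x) → h i ≈ h j)
      × (∀ i j → h (i + j) ≈ h i ∙ h j)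
      × (∀ i → InLocalGroup Y ν (h i))
      × (∀ a → InLocalGroup Y ν a → ∃ λ i → h i ≈ a)

-- Sums of the harmonic flow ξ along walks of X depend only on the end vertices: a closed
-- walk repeating a vertex splits into two shorter closed walks, so every closed-walk sum lies
-- in the subgroup generated by cycle sums, all of which vanish. Hence h(k), the ξ-sum of a
-- walk from a fixed dart to its image under fᵏ, is additive in k, and h(N) = 0 whenever
-- fᴺ = id; such N > 0 exists by semiregularity on darts, so the values of h form a subgroup.
-- Projecting that walk gives a closed walk of Y, so h(k) ∈ A^ξ̄; conversely an oriented cycle
-- of Y lifts to a walk of X from x to the vertex of some fᵐ x, so its sum is h(m).
-- Semiregularity on vertices makes φ bijective on the darts at each vertex, so the vertex
-- sums of ξ̄ are those of ξ.
{-# OPTIONS --safe #-}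
module Submission where

open import Defs
open import Data.Nat using (ℕ; zero; suc; _+_; _*_; _≤_; _<_; z≤n; s≤s)
import Data.Nat.Properties as ℕ
open import Data.Fin using (Fin; zero; suc; inject₁; fromℕ; toℕ; _≟_)
import Data.Fin.Properties as Fin
open import Data.Product using (Σ; ∃; ∃₂; _×_; _,_)
open import Data.Sum using (_⊎_; inj₁; inj₂)
open import Data.Unit using (⊤; tt)
open import Data.Empty using (⊥-elim)
open import Function using (_∘_)
open import Relation.Nullary using (Dec; yes; no; ¬_)
open import Relation.Binary using (IsEquivalence)
open import Relation.Binary.PropositionalEquality as ≡ using (_≡_; _≢_)
open import Relation.Binary.Construct.Closure.ReflexiveTransitive using (Star; _◅_)
import Relation.Binary.Construct.Closure.ReflexiveTransitive as Star
open import Algebra.Bundles using (AbelianGroup)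

iter-+ : ∀ {a} {D : Set a} (f : D → D) m n x → iter f (m + n) x ≡ iter f m (iter f n x)
iter-+ f zero    n x = ≡.refl
iter-+ f (suc m) n x = ≡.cong f (iter-+ f m n x)

iter-periodicPoint : ∀ {n} (f : Fin n → Fin n) (x : Fin n) →
                     ∃₂ λ i p → iter f (suc p) (iter f i x) ≡ iter f i x
iter-periodicPoint {n} f x
  with i , j , i<j , fⁱx≡fʲx ← Fin.pigeonhole (ℕ.n<1+n n) (λ k → iter f (toℕ k) x)
  with p , i+1+p≡j ← ℕ.m≤n⇒∃[o]m+o≡n i<j
  = toℕ i , p , (begin
      iter f (suc p) (iter f (toℕ i) x)  ≡⟨ iter-+ f (suc p) (toℕ i) x ⟨
      iter f (suc p + toℕ i) x           ≡⟨ ≡.cong (λ k → iter f k x) p+1+i≡j ⟩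
      iter f (toℕ j) x                   ≡⟨ fⁱx≡fʲx ⟨
      iter f (toℕ i) x                   ∎)
  where
  open ≡.≡-Reasoning
  p+1+i≡j : suc p + toℕ i ≡ toℕ j
  p+1+i≡j = ≡.trans (≡.cong suc (ℕ.+-comm p (toℕ i))) i+1+p≡j

semiregular⇒finiteOrder : ∀ X f → SemiregularOnDarts X f → ∃ λ N → ∀ x → iter f (suc N) x ≡ x
semiregular⇒finiteOrder X f semiregular
  with _ , N , fixed ← iter-periodicPoint f zero = N , semiregular (suc N) _ fixed

module FiniteSums {c ℓ} (A : AbelianGroup c ℓ) where
  open AbelianGroup A
  open import Algebra.Properties.CommutativeMonoid.Sum commutativeMonoid public
    using (sum; sum-cong-≋; ∑-comm)
  open import Algebra.Properties.CommutativeMonoid.Sum commutativeMonoid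
    using (sum-replicate-zero; sum-remove)

  sumFin≡sum : ∀ m (g : Fin m → Carrier) → sumFin A m g ≡ sum g
  sumFin≡sum zero    g = ≡.refl
  sumFin≡sum (suc m) g = ≡.cong (g zero ∙_) (sumFin≡sum m (g ∘ suc))

  sum-≈ε : ∀ {m} {g : Fin m → Carrier} → (∀ i → g i ≈ ε) → sum g ≈ ε
  sum-≈ε {m} g≈ε = trans (sum-cong-≋ g≈ε) (sum-replicate-zero m)

  sum-single : ∀ {m} (g : Fin (suc m) → Carrier) i₀ → (∀ i → i ≢ i₀ → g i ≈ ε) → sum g ≈ g i₀
  sum-single g i₀ g≈ε = trans (sum-remove {i = i₀} g)
    (trans (∙-congˡ (sum-≈ε (λ j → g≈ε _ (Fin.punchInᵢ≢i i₀ j)))) (identityʳ (g i₀)))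

  select-yes : ∀ {p} {P : Set p} (P? : Dec P) {a} → P → select A P? a ≡ a
  select-yes (yes _) _ = ≡.refl
  select-yes (no ¬p) p = ⊥-elim (¬p p)

  select-no : ∀ {p} {P : Set p} (P? : Dec P) {a} → ¬ P → select A P? a ≡ ε
  select-no (yes p) ¬p = ⊥-elim (¬p p)
  select-no (no _)  _  = ≡.refl

  select-select-no : ∀ {p q} {P : Set p} {Q : Set q} (P? : Dec P) (Q? : Dec Q) {a} →
                     (P → ¬ Q) → select A P? (select A Q? a) ≡ ε
  select-select-no (yes p) Q? P⇒¬Q = select-no Q? (P⇒¬Q p)
  select-select-no (no _)  Q? P⇒¬Q = ≡.refl

  sum-select-≟ : ∀ {m} (i : Fin (suc m)) a → sum (λ j → select A (i ≟ j) a) ≈ a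
  sum-select-≟ i a = trans (sum-single _ i (λ j j≢i → reflexive (select-no (i ≟ j) (j≢i ∘ ≡.sym))))
                           (reflexive (select-yes (i ≟ i) ≡.refl))

module GeneratedSubgroup {c ℓ} (A : AbelianGroup c ℓ) where
  open AbelianGroup A
  open import Algebra.Properties.Group group using (inverseˡ-unique; identityˡ-unique; ε⁻¹≈ε)

  module _ {p} {S : Carrier → Set p} where

    Gen-resp : ∀ {a b} → a ≈ b → Gen A S a → Gen A S b
    Gen-resp a≈b (gen s x)     = gen s (trans (sym a≈b) x)
    Gen-resp a≈b (unit x)      = unit (trans (sym a≈b) x)
    Gen-resp a≈b (ginv g x)    = ginv g (trans (sym a≈b) x)
    Gen-resp a≈b (gmul g g' x) = gmul g g' (trans (sym a≈b) x)

    Gen-mono : ∀ {q} {T : Carrier → Set q} → (∀ {a} → S a → T a) → ∀ {b} → Gen A S b → Gen A T b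
    Gen-mono S⊆T (gen s x)     = gen (S⊆T s) x
    Gen-mono S⊆T (unit x)      = unit x
    Gen-mono S⊆T (ginv g x)    = ginv (Gen-mono S⊆T g) x
    Gen-mono S⊆T (gmul g g' x) = gmul (Gen-mono S⊆T g) (Gen-mono S⊆T g') x

    Gen-trivial : (∀ {a} → S a → a ≈ ε) → ∀ {b} → Gen A S b → b ≈ ε
    Gen-trivial S≈ε (gen s x)     = trans x (S≈ε s)
    Gen-trivial S≈ε (unit x)      = x
    Gen-trivial S≈ε (ginv g x)    = trans x (trans (⁻¹-cong (Gen-trivial S≈ε g)) ε⁻¹≈ε)
    Gen-trivial S≈ε (gmul g g' x) =
      trans x (trans (∙-cong (Gen-trivial S≈ε g) (Gen-trivial S≈ε g')) (identityˡ ε))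

    Gen⊆image : (h : ℕ → Carrier) (N : ℕ) → (∀ i j → h (i + j) ≈ h i ∙ h j) → h (suc N) ≈ ε →
                (∀ {a} → S a → ∃ λ i → h i ≈ a) → ∀ {a} → Gen A S a → ∃ λ i → h i ≈ a
    Gen⊆image h N h-hom h-period S⊆image = image
      where
      h0≈ε : h 0 ≈ ε
      h0≈ε = identityˡ-unique (h 0) (h 0) (sym (h-hom 0 0))

      h-periodic : ∀ i → h (i * suc N) ≈ ε
      h-periodic zero    = h0≈ε
      h-periodic (suc i) =
        trans (h-hom (suc N) (i * suc N)) (trans (∙-cong h-period (h-periodic i)) (identityˡ ε))

      h-inverse : ∀ i → h (i * N) ≈ h i ⁻¹
      h-inverse i = inverseˡ-unique (h (i * N)) (h i) (begin
        h (i * N) ∙ h i   ≈⟨ h-hom (i * N) i ⟨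
        h (i * N + i)     ≡⟨ ≡.cong h (≡.trans (ℕ.+-comm (i * N) i) (≡.sym (ℕ.*-suc i N))) ⟩
        h (i * suc N)     ≈⟨ h-periodic i ⟩
        ε                 ∎)
        where open import Relation.Binary.Reasoning.Setoid setoid

      image : ∀ {a} → Gen A S a → ∃ λ i → h i ≈ a
      image (gen s b≈a) = let i , hi≈a = S⊆image s in i , trans hi≈a (sym b≈a)
      image (unit b≈ε)  = 0 , trans h0≈ε (sym b≈ε)
      image (ginv g b≈a⁻¹) =
        let i , hi≈a = image g in i * N , trans (h-inverse i) (trans (⁻¹-cong hi≈a) (sym b≈a⁻¹))
      image (gmul g g' b≈aa') =
        let i , hi≈a = image g ; j , hj≈a' = image g'
        in i + j , trans (h-hom i j) (trans (∙-cong hi≈a hj≈a') (sym b≈aa'))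

module VertexRelation (G : Graph) where
  infix 4 _~_
  _~_ : Dart G → Dart G → Set
  _~_ = _∼_ G
  open IsEquivalence (∼-equiv G) public
    using () renaming (refl to ~-refl; sym to ~-sym; trans to ~-trans; reflexive to ≡⇒~)

-- A walk from the vertex of u to the vertex of v: step d leaves along the dart d
-- and continues from the vertex of d⁻¹.
module Walks (G : Graph) where
  open VertexRelation G

  data Walk : Dart G → Dart G → Set where
    stay : ∀ {u v} → u ~ v → Walk u v
    step : ∀ {u v} d → u ~ d → Walk (inv G d) v → Walk u v

  length : ∀ {u v} → Walk u v → ℕ
  length (stay _)     = zero
  length (step _ _ w) = suc (length w)

  darts : ∀ {u v} (w : Walk u v) → Fin (length w) → Dart G
  darts (step d _ w) zero    = d
  darts (step d _ w) (suc i) = darts w i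

  respˡ : ∀ {u u' v} → u ~ u' → Walk u v → Walk u' v
  respˡ u~u' (stay u~v)     = stay (~-trans (~-sym u~u') u~v)
  respˡ u~u' (step d u~d w) = step d (~-trans (~-sym u~u') u~d) w

  respʳ : ∀ {u v v'} → v ~ v' → Walk u v → Walk u v'
  respʳ v~v' (stay u~v)     = stay (~-trans u~v v~v')
  respʳ v~v' (step d u~d w) = step d u~d (respʳ v~v' w)

  infixr 5 _++_
  _++_ : ∀ {u v w} → Walk u v → Walk v w → Walk u w
  stay u~v     ++ q = respˡ (~-sym u~v) q
  step d u~d p ++ q = step d u~d (p ++ q)

  fromStar : ∀ {x y} → Star (Step G) x y → Walk x y
  fromStar Star.ε             = stay ~-refl
  fromStar (same x~y ◅ s)     = respˡ (~-sym x~y) (fromStar s)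
  fromStar (cross ≡.refl ◅ s) = step _ ~-refl (fromStar s)

  linkedWalk : ∀ k (g : Fin (suc k) → Dart G) → (∀ i → g (suc i) ~ inv G (g (inject₁ i))) →
               Walk (g zero) (inv G (g (fromℕ k)))
  linkedWalk zero    g linked = step (g zero) ~-refl (stay ~-refl)
  linkedWalk (suc k) g linked =
    step (g zero) ~-refl (respˡ (linked zero) (linkedWalk k (g ∘ suc) (linked ∘ suc)))

  cycleWalk : (C : OrientedCycle G) →
              Walk (OrientedCycle.dart C zero) (inv G (OrientedCycle.dart C (fromℕ (OrientedCycle.k C))))
  cycleWalk C = linkedWalk k dart linked where open OrientedCycle C

  Distinct : ∀ {u v} → Walk u v → Set
  Distinct (stay _)     = ⊤
  Distinct (step d _ w) = (∀ j → ¬ d ~ darts w j) × Distinct w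

  darts-linked : ∀ {u v} d (u~d : u ~ d) (w : Walk (inv G d) v) (i : Fin (length w)) →
                 darts w i ~ inv G (darts (step d u~d w) (inject₁ i))
  darts-linked d _ (step d' d⁻¹~d' w) zero    = ~-sym d⁻¹~d'
  darts-linked d _ (step d' d⁻¹~d' w) (suc i) = darts-linked d' d⁻¹~d' w i

  darts-last : ∀ {u v} d (u~d : u ~ d) (w : Walk (inv G d) v) →
               v ~ inv G (darts (step d u~d w) (fromℕ (length w)))
  darts-last d _ (stay d⁻¹~v)        = ~-sym d⁻¹~v
  darts-last d _ (step d' d⁻¹~d' w) = darts-last d' d⁻¹~d' w

  darts-injective : ∀ {u v} (w : Walk u v) → Distinct w → ∀ i j → darts w i ~ darts w j → i ≡ j
  darts-injective (step d _ w) _            zero    zero    _ = ≡.refl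
  darts-injective (step d _ w) (d≁w , _)    zero    (suc j) s = ⊥-elim (d≁w j s)
  darts-injective (step d _ w) (d≁w , _)    (suc i) zero    s = ⊥-elim (d≁w i (~-sym s))
  darts-injective (step d _ w) (_ , w-dist) (suc i) (suc j) s =
    ≡.cong suc (darts-injective w w-dist i j s)

  closedPath⇒cycle : ∀ {u v} d (u~d : u ~ d) (w : Walk (inv G d) v) →
                     u ~ v → Distinct (step d u~d w) → OrientedCycle G
  closedPath⇒cycle d u~d w u~v distinct = record
    { k        = length w
    ; dart     = darts (step d u~d w)
    ; linked   = darts-linked d u~d w
    ; closed   = ~-trans (~-sym u~d) (~-trans u~v (darts-last d u~d w))
    ; distinct = darts-injective (step d u~d w) distinct
    }

record IsHomomorphism (G H : Graph) (m : Dart G → Dart H) : Set where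
  field
    pres-∼   : ∀ {x y} → _∼_ G x y → _∼_ H (m x) (m y)
    comm-inv : ∀ x → inv H (m x) ≡ m (inv G x)

iter-isHomomorphism : ∀ {X f} → IsAutomorphism X f → ∀ k → IsHomomorphism X X (iter f k)
iter-isHomomorphism {X} {f} aut k = record { pres-∼ = pres k ; comm-inv = comm k }
  where
  open IsAutomorphism aut
  pres : ∀ k {x y} → _∼_ X x y → _∼_ X (iter f k x) (iter f k y)
  pres zero    x∼y = x∼y
  pres (suc k) x∼y = pres-∼ (pres k x∼y)
  comm : ∀ k x → inv X (iter f k x) ≡ iter f k (inv X x)
  comm zero    x = ≡.refl
  comm (suc k) x = ≡.trans (comm-inv (iter f k x)) (≡.cong f (comm k x))

mapWalk : ∀ {G H m} → IsHomomorphism G H m → ∀ {u v} → Walks.Walk G u v → Walks.Walk H (m u) (m v)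
mapWalk {G} {H} {m} hom = go
  where
  open IsHomomorphism hom
  open Walks
  go : ∀ {u v} → Walk G u v → Walk H (m u) (m v)
  go (stay u~v)     = stay (pres-∼ u~v)
  go (step d u~d w) = step (m d) (pres-∼ u~d) (respˡ H m[d⁻¹]~[md]⁻¹ (go w))
    where
    m[d⁻¹]~[md]⁻¹ : _∼_ H (m (inv G d)) (inv H (m d))
    m[d⁻¹]~[md]⁻¹ = VertexRelation.≡⇒~ H (≡.sym (comm-inv d))

module WalkSums {c ℓ} (A : AbelianGroup c ℓ) (G : Graph) (ν : Dart G → AbelianGroup.Carrier A) where
  open AbelianGroup A
  open import Algebra.Properties.CommutativeSemigroup commutativeSemigroup using (x∙yz≈y∙xz)
  open VertexRelation G
  open Walks G

  walkSum : ∀ {u v} → Walk u v → Carrier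
  walkSum (stay _)     = ε
  walkSum (step d _ w) = ν d ∙ walkSum w

  walkSum-respˡ : ∀ {u u' v} (u~u' : u ~ u') (w : Walk u v) → walkSum (respˡ u~u' w) ≡ walkSum w
  walkSum-respˡ _ (stay _)     = ≡.refl
  walkSum-respˡ _ (step _ _ _) = ≡.refl

  walkSum-respʳ : ∀ {u v v'} (v~v' : v ~ v') (w : Walk u v) → walkSum (respʳ v~v' w) ≡ walkSum w
  walkSum-respʳ _    (stay _)     = ≡.refl
  walkSum-respʳ v~v' (step d _ w) = ≡.cong (ν d ∙_) (walkSum-respʳ v~v' w)

  walkSum-++ : ∀ {u v w} (p : Walk u v) (q : Walk v w) → walkSum (p ++ q) ≈ walkSum p ∙ walkSum q
  walkSum-++ (stay u~v)   q = trans (reflexive (walkSum-respˡ _ q)) (sym (identityˡ _))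
  walkSum-++ (step d _ p) q = trans (∙-congˡ (walkSum-++ p q)) (sym (assoc _ _ _))

  walkSum≡sumFin : ∀ {u v} (w : Walk u v) → walkSum w ≡ sumFin A (length w) (ν ∘ darts w)
  walkSum≡sumFin (stay _)     = ≡.refl
  walkSum≡sumFin (step d _ w) = ≡.cong (ν d ∙_) (walkSum≡sumFin w)

  walkSum-linkedWalk : ∀ k g linked → walkSum (linkedWalk k g linked) ≈ sumFin A (suc k) (ν ∘ g)
  walkSum-linkedWalk zero    g linked = refl
  walkSum-linkedWalk (suc k) g linked = ∙-congˡ (trans (reflexive (walkSum-respˡ (linked zero) w))
                                                        (walkSum-linkedWalk k (g ∘ suc) (linked ∘ suc)))
    where
    w : Walk (g (suc zero)) (inv G (g (fromℕ (suc k))))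
    w = linkedWalk k (g ∘ suc) (linked ∘ suc)

  walkSum-cycleWalk : (C : OrientedCycle G) → walkSum (cycleWalk C) ≈ cycleSum A G ν C
  walkSum-cycleWalk C = walkSum-linkedWalk k dart linked where open OrientedCycle C

  record SplitAt {u v} (w : Walk u v) (j : Fin (length w)) : Set ℓ where
    field
      a              : Dart G
      before         : Walk u a
      a~dⱼ           : a ~ darts w j
      after          : Walk (inv G (darts w j)) v
      before-shorter : length before < length w
      after-shorter  : length after < length w
      walkSum-split  : walkSum w ≈ walkSum before ∙ (ν (darts w j) ∙ walkSum after)

  splitAt : ∀ {u v} (w : Walk u v) j → SplitAt w j
  splitAt {u} (step d u~d w) zero = record
    { a = u ; before = stay ~-refl ; a~dⱼ = u~d ; after = w
    ; before-shorter = s≤s z≤n ; after-shorter = ℕ.≤-refl ; walkSum-split = sym (identityˡ _) }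
  splitAt (step d u~d w) (suc j) = record
    { a = a ; before = step d u~d before ; a~dⱼ = a~dⱼ ; after = after
    ; before-shorter = s≤s before-shorter ; after-shorter = ℕ.m≤n⇒m≤1+n after-shorter
    ; walkSum-split = trans (∙-congˡ walkSum-split) (sym (assoc _ _ _)) }
    where open SplitAt (splitAt w j)

  record Shortcut {u v} (w : Walk u v) : Set ℓ where
    field
      a b           : Dart G
      a~b           : a ~ b
      loop          : Walk a b
      rest          : Walk u v
      loop-shorter  : length loop < length w
      rest-shorter  : length rest < length w
      walkSum-split : walkSum w ≈ walkSum loop ∙ walkSum rest

  distinct⊎shortcut : ∀ {u v} (w : Walk u v) → Distinct w ⊎ Shortcut w
  distinct⊎shortcut (stay _) = inj₁ tt
  distinct⊎shortcut (step d u~d w) with distinct⊎shortcut w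
  ... | inj₂ s = inj₂ (record
    { a = a ; b = b ; a~b = a~b ; loop = loop ; rest = step d u~d rest
    ; loop-shorter = ℕ.m≤n⇒m≤1+n loop-shorter ; rest-shorter = s≤s rest-shorter
    ; walkSum-split = trans (∙-congˡ walkSum-split) (x∙yz≈y∙xz _ _ _) })
    where open Shortcut s
  ... | inj₁ w-distinct with Fin.any? (λ j → ∼-dec G d (darts w j))
  ...   | no d≁w         = inj₁ ((λ j d~dⱼ → d≁w (j , d~dⱼ)) , w-distinct)
  ...   | yes (j , d~dⱼ) = inj₂ (record
    { a = d ; b = a ; a~b = ~-trans d~dⱼ (~-sym a~dⱼ)
    ; loop = step d ~-refl before ; rest = step (darts w j) (~-trans u~d d~dⱼ) after
    ; loop-shorter = s≤s before-shorter ; rest-shorter = s≤s after-shorter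
    ; walkSum-split = trans (∙-congˡ walkSum-split) (sym (assoc _ _ _)) })
    where open SplitAt (splitAt w j)

  closedWalk∈LocalGroup : ∀ {u v} → u ~ v → (w : Walk u v) → InLocalGroup A G ν (walkSum w)
  closedWalk∈LocalGroup u~v w = bounded (length w) w ℕ.≤-refl u~v
    where
    bounded : ∀ n {u v} (w : Walk u v) → length w ≤ n → u ~ v → InLocalGroup A G ν (walkSum w)
    bounded _       (stay _)       _           _   = unit refl
    bounded (suc n) (step d u~d w) (s≤s |w|≤n) u~v with distinct⊎shortcut (step d u~d w)
    ... | inj₁ distinct = gen (closedPath⇒cycle d u~d w u~v distinct , refl)
                              (reflexive (walkSum≡sumFin (step d u~d w)))
    ... | inj₂ s = gmul (bounded n loop (shorter loop-shorter) a~b)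
                        (bounded n rest (shorter rest-shorter) u~v) walkSum-split
      where
      open Shortcut s
      shorter : ∀ {m} → m < suc (length w) → m ≤ n
      shorter m<|w|+1 = ℕ.≤-trans (ℕ.≤-pred m<|w|+1) |w|≤n

module _ {c ℓ} (A : AbelianGroup c ℓ) {G H : Graph} {m : Dart G → Dart H} (hom : IsHomomorphism G H m)
         {νG : Dart G → AbelianGroup.Carrier A} {νH : Dart H → AbelianGroup.Carrier A} where
  open AbelianGroup A
  open Walks G
  private
    module SumG = WalkSums A G νG
    module SumH = WalkSums A H νH

  walkSum-mapWalk : (∀ x → νH (m x) ≈ νG x) → ∀ {u v} (w : Walk u v) →
                    SumH.walkSum (mapWalk hom w) ≈ SumG.walkSum w
  walkSum-mapWalk ν-pres (stay _)     = refl
  walkSum-mapWalk ν-pres (step d _ w) =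
    ∙-cong (ν-pres d) (trans (reflexive (SumH.walkSum-respˡ _ (mapWalk hom w))) (walkSum-mapWalk ν-pres w))

module Projection {X : Graph} {f : Dart X → Dart X} {Y : Graph} {φ : Dart X → Dart Y}
                  (aut : IsAutomorphism X f) (quotient : IsQuotientBy X f Y φ) where
  open IsQuotientBy quotient
  open VertexRelation X
  open VertexRelation Y using ()
    renaming (_~_ to _~ʸ_; ~-sym to ~ʸ-sym; ~-trans to ~ʸ-trans; ≡⇒~ to ≡⇒~ʸ)
  open Walks

  φ-isHomomorphism : IsHomomorphism X Y φ
  φ-isHomomorphism = record { pres-∼ = ⇐vtx _ _ ; comm-inv = inv-comm }

  φ-iter : ∀ k x → φ (iter f k x) ≡ φ x
  φ-iter k x = ≡.sym (⇐orbit x (iter f k x) k ≡.refl)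

  liftDart : ∀ {x ȳ} → φ x ~ʸ ȳ → ∃ λ y → x ~ y × φ y ≡ ȳ
  liftDart {x} {ȳ} φx~ȳ
    with y₁ , φy₁≡ȳ ← surj ȳ
    with x' , y' , φx'≡φx , φy'≡φy₁ , x'~y' ← vtx⇒ x y₁ (~ʸ-trans φx~ȳ (≡⇒~ʸ (≡.sym φy₁≡ȳ)))
    with k , fᵏx'≡x ← orbit⇒ x' x φx'≡φx
    = iter f k y'
    , ~-trans (≡⇒~ (≡.sym fᵏx'≡x)) (IsHomomorphism.pres-∼ (iter-isHomomorphism aut k) x'~y')
    , ≡.trans (φ-iter k y') (≡.trans φy'≡φy₁ φy₁≡ȳ)

  vertex⇒orbit : ∀ {z x} → φ z ~ʸ φ x → ∃ λ k → z ~ iter f k x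
  vertex⇒orbit {z} {x} φz~φx
    with y , z~y , φy≡φx ← liftDart φz~φx
    with k , fᵏx≡y ← orbit⇒ x y (≡.sym φy≡φx)
    = k , ~-trans z~y (≡⇒~ (≡.sym fᵏx≡y))

  fibre-unique : SemiregularOnVertices X f → ∀ {x y y'} → y ~ x → y' ~ x → φ y ≡ φ y' → y ≡ y'
  fibre-unique semiregular {y = y} {y'} y~x y'~x φy≡φy'
    with k , fᵏy≡y' ← orbit⇒ y y' φy≡φy'
    = ≡.trans (≡.sym (semiregular k y (~-trans (≡⇒~ fᵏy≡y') (~-trans y'~x (~-sym y~x))) y)) fᵏy≡y'

  module _ {c ℓ} (A : AbelianGroup c ℓ) {ξ : Dart X → AbelianGroup.Carrier A}
           {ξ̄ : Dart Y → AbelianGroup.Carrier A} (ξ̄∘φ≈ξ : ∀ x → AbelianGroup._≈_ A (ξ̄ (φ x)) (ξ x)) where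
    open AbelianGroup A
    open FiniteSums A
    private
      module SumX = WalkSums A X ξ
      module SumY = WalkSums A Y ξ̄

    liftWalk : ∀ {ū v̄} (w̄ : Walk Y ū v̄) x → φ x ~ʸ ū →
               ∃₂ λ z (w : Walk X x z) → φ z ~ʸ v̄ × SumX.walkSum w ≈ SumY.walkSum w̄
    liftWalk (stay ū~v̄) x φx~ū = x , stay ~-refl , ~ʸ-trans φx~ū ū~v̄ , refl
    liftWalk (step d̄ ū~d̄ w̄) x φx~ū
      with d , x~d , φd≡d̄ ← liftDart (~ʸ-trans φx~ū ū~d̄)
      with z , w , φz~v̄ , walkSum≈ ← liftWalk w̄ (inv X d)
                                       (≡⇒~ʸ (≡.trans (≡.sym (inv-comm d)) (≡.cong (inv Y) φd≡d̄)))
      = z , step d x~d w , φz~v̄ , ∙-cong (trans (sym (ξ̄∘φ≈ξ d)) (reflexive (≡.cong ξ̄ φd≡d̄))) walkSum≈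

    vertexSum-φ : SemiregularOnVertices X f → ∀ x → vertexSum A Y ξ̄ (φ x) ≈ vertexSum A X ξ x
    vertexSum-φ semiregular x = begin
      vertexSum A Y ξ̄ (φ x)             ≡⟨ sumFin≡sum _ ξ̄-at ⟩
      sum ξ̄-at                          ≈⟨ sum-cong-≋ fibreSum ⟨
      sum (λ ȳ → sum (term ȳ))          ≈⟨ ∑-comm term ⟩
      sum (λ y → sum (λ ȳ → term ȳ y))  ≈⟨ sum-cong-≋ (λ y → sum-select-≟ (φ y) (ξ-at y)) ⟩
      sum ξ-at                          ≡⟨ sumFin≡sum _ ξ-at ⟨
      vertexSum A X ξ x                 ∎
      where
      open import Relation.Binary.Reasoning.Setoid setoid

      ξ-at : Dart X → Carrier
      ξ-at y = select A (∼-dec X y x) (ξ y)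

      ξ̄-at : Dart Y → Carrier
      ξ̄-at ȳ = select A (∼-dec Y ȳ (φ x)) (ξ̄ ȳ)

      term : Dart Y → Dart X → Carrier
      term ȳ y = select A (φ y ≟ ȳ) (ξ-at y)

      fibreSum : ∀ ȳ → sum (term ȳ) ≈ ξ̄-at ȳ
      fibreSum ȳ with ∼-dec Y ȳ (φ x)
      ... | no ȳ≁φx = sum-≈ε (λ y → reflexive (select-select-no (φ y ≟ ȳ) (∼-dec X y x) {ξ y}
              (λ φy≡ȳ y~x → ȳ≁φx (~ʸ-trans (≡⇒~ʸ (≡.sym φy≡ȳ)) (⇐vtx y x y~x)))))
      ... | yes ȳ~φx with y₀ , x~y₀ , φy₀≡ȳ ← liftDart (~ʸ-sym ȳ~φx) = begin
        sum (term ȳ) ≈⟨ sum-single (term ȳ) y₀ off-y₀ ⟩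
        term ȳ y₀    ≡⟨ ≡.trans (select-yes (φ y₀ ≟ ȳ) φy₀≡ȳ) (select-yes (∼-dec X y₀ x) (~-sym x~y₀)) ⟩
        ξ y₀         ≈⟨ ξ̄∘φ≈ξ y₀ ⟨
        ξ̄ (φ y₀)     ≡⟨ ≡.cong ξ̄ φy₀≡ȳ ⟩
        ξ̄ ȳ          ∎
        where
        off-y₀ : ∀ y → y ≢ y₀ → term ȳ y ≈ ε
        off-y₀ y y≢y₀ = reflexive (select-select-no (φ y ≟ ȳ) (∼-dec X y x) {ξ y} λ φy≡ȳ y~x →
          y≢y₀ (fibre-unique semiregular y~x (~-sym x~y₀) (≡.trans φy≡ȳ (≡.sym φy₀≡ȳ))))

module HarmonicWalks {c ℓ} (A : AbelianGroup c ℓ) (X : Graph) (connected : Connected X)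
                     (ξ : Dart X → AbelianGroup.Carrier A) (harmonic : IsHarmonic A X ξ) where
  open AbelianGroup A
  open GeneratedSubgroup A using (Gen-trivial)
  open import Algebra.Properties.Group group using (inverseˡ-unique)
  open import Relation.Binary.Reasoning.Setoid setoid
  open VertexRelation X
  open Walks X
  open WalkSums A X ξ

  connect : ∀ x y → Walk x y
  connect x y = fromStar (connected x y)

  closedWalkSum≈ε : ∀ {u v} → u ~ v → (w : Walk u v) → walkSum w ≈ ε
  closedWalkSum≈ε u~v w = Gen-trivial (λ { (C , cycleSum≈a) → trans (sym cycleSum≈a) (cycleZero C) })
                                      (closedWalk∈LocalGroup u~v w)
    where open IsHarmonic harmonic

  closedWalkSum-++ : ∀ {u v w} → u ~ w → (p : Walk u v) (q : Walk v w) → walkSum p ∙ walkSum q ≈ ε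
  closedWalkSum-++ u~w p q = trans (sym (walkSum-++ p q)) (closedWalkSum≈ε u~w (p ++ q))

  walkSum-indep : ∀ {x x' y y'} → x ~ x' → y ~ y' → (p : Walk x y) (q : Walk x' y') →
                  walkSum p ≈ walkSum q
  walkSum-indep {x} {y' = y'} x~x' y~y' p q = begin
    walkSum p                ≡⟨ walkSum-respʳ y~y' p ⟨
    walkSum (respʳ y~y' p)   ≈⟨ inverseˡ-unique _ _ (closedWalkSum-++ ~-refl (respʳ y~y' p) back) ⟩
    walkSum back ⁻¹          ≈⟨ inverseˡ-unique _ _ (closedWalkSum-++ (~-sym x~x') q back) ⟨
    walkSum q                ∎
    where
    back : Walk y' x
    back = connect y' x

module OrbitSums {c ℓ} (A : AbelianGroup c ℓ) (X : Graph) (connected : Connected X)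
                 (ξ : Dart X → AbelianGroup.Carrier A) (harmonic : IsHarmonic A X ξ)
                 (f : Dart X → Dart X) (aut : IsAutomorphism X f)
                 (ξ∘f≈ξ : ∀ x → AbelianGroup._≈_ A (ξ (f x)) (ξ x)) where
  open AbelianGroup A
  open import Algebra.Properties.CommutativeSemigroup commutativeSemigroup using (x∙yz≈y∙xz)
  open import Relation.Binary.Reasoning.Setoid setoid
  open VertexRelation X
  open Walks X
  open WalkSums A X ξ
  open HarmonicWalks A X connected ξ harmonic

  base : Dart X
  base = zero

  orbitWalk : ∀ k → Walk base (iter f k base)
  orbitWalk k = connect base (iter f k base)

  orbitSum : ℕ → Carrier
  orbitSum k = walkSum (orbitWalk k)

  ξ∘fᵏ≈ξ : ∀ k x → ξ (iter f k x) ≈ ξ x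
  ξ∘fᵏ≈ξ zero    x = refl
  ξ∘fᵏ≈ξ (suc k) x = trans (ξ∘f≈ξ (iter f k x)) (ξ∘fᵏ≈ξ k x)

  shift : ∀ k {u v} → Walk u v → Walk (iter f k u) (iter f k v)
  shift k = mapWalk (iter-isHomomorphism aut k)

  walkSum-shift : ∀ k {u v} (w : Walk u v) → walkSum (shift k w) ≈ walkSum w
  walkSum-shift k = walkSum-mapWalk A (iter-isHomomorphism aut k) (ξ∘fᵏ≈ξ k)

  walkSum≈orbitSum : ∀ {x} k (w : Walk x (iter f k x)) → walkSum w ≈ orbitSum k
  walkSum≈orbitSum {x} k w = begin
    walkSum w                                      ≈⟨ identityʳ _ ⟨
    walkSum w ∙ ε                                  ≈⟨ ∙-congˡ (closedWalkSum-++ ~-refl there back) ⟨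
    walkSum w ∙ (walkSum there ∙ walkSum back)     ≈⟨ x∙yz≈y∙xz _ _ _ ⟩
    walkSum there ∙ (walkSum w ∙ walkSum back)     ≈⟨ ∙-congˡ (∙-congˡ (walkSum-shift k back)) ⟨
    walkSum there ∙ (walkSum w ∙ walkSum backᵏ)    ≈⟨ ∙-congˡ (walkSum-++ w backᵏ) ⟨
    walkSum there ∙ walkSum (w ++ backᵏ)           ≈⟨ walkSum-++ there (w ++ backᵏ) ⟨
    walkSum loop                                   ≈⟨ walkSum-indep ~-refl ~-refl loop (orbitWalk k) ⟩
    orbitSum k                                     ∎
    where
    there : Walk base x
    there = connect base x
    back : Walk x base
    back = connect x base
    backᵏ : Walk (iter f k x) (iter f k base)
    backᵏ = shift k back
    loop : Walk base (iter f k base)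
    loop = there ++ w ++ backᵏ

  orbitSum-cong : ∀ i j → (∀ x → iter f i x ≡ iter f j x) → orbitSum i ≈ orbitSum j
  orbitSum-cong i j fⁱ≗fʲ = walkSum-indep ~-refl (≡⇒~ (fⁱ≗fʲ base)) (orbitWalk i) (orbitWalk j)

  orbitSum-+ : ∀ i j → orbitSum (i + j) ≈ orbitSum i ∙ orbitSum j
  orbitSum-+ i j = begin
    orbitSum (i + j)                             ≈⟨ walkSum≈orbitSum (i + j) (respʳ fⁱfʲ~fⁱ⁺ʲ w) ⟨
    walkSum (respʳ fⁱfʲ~fⁱ⁺ʲ w)                  ≡⟨ walkSum-respʳ fⁱfʲ~fⁱ⁺ʲ w ⟩
    walkSum w                                    ≈⟨ walkSum-++ (orbitWalk i) (shift i (orbitWalk j)) ⟩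
    orbitSum i ∙ walkSum (shift i (orbitWalk j)) ≈⟨ ∙-congˡ (walkSum-shift i (orbitWalk j)) ⟩
    orbitSum i ∙ orbitSum j                      ∎
    where
    w : Walk base (iter f i (iter f j base))
    w = orbitWalk i ++ shift i (orbitWalk j)
    fⁱfʲ~fⁱ⁺ʲ : iter f i (iter f j base) ~ iter f (i + j) base
    fⁱfʲ~fⁱ⁺ʲ = ≡⇒~ (≡.sym (iter-+ f i j base))

  orbitSum-period : ∀ N → (∀ x → iter f N x ≡ x) → orbitSum N ≈ ε
  orbitSum-period N fᴺ≗id = closedWalkSum≈ε (≡⇒~ (≡.sym (fᴺ≗id base))) (orbitWalk N)

module QuotientFlow {c ℓ} (A : AbelianGroup c ℓ) (X : Graph) (connected : Connected X)
                    (ξ : Dart X → AbelianGroup.Carrier A) (harmonic : IsHarmonic A X ξ)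
                    (f : Dart X → Dart X) (aut : IsAutomorphism X f)
                    (ξ∘f≈ξ : ∀ x → AbelianGroup._≈_ A (ξ (f x)) (ξ x))
                    {Y : Graph} {φ : Dart X → Dart Y} (quotient : IsQuotientBy X f Y φ)
                    (ξ̄ : Dart Y → AbelianGroup.Carrier A)
                    (ξ̄∘φ≈ξ : ∀ x → AbelianGroup._≈_ A (ξ̄ (φ x)) (ξ x)) where
  open AbelianGroup A
  open GeneratedSubgroup A using (Gen-resp; Gen-mono)
  open import Relation.Binary.Reasoning.Setoid setoid
  open IsQuotientBy quotient
  open Projection aut quotient
  open OrbitSums A X connected ξ harmonic f aut ξ∘f≈ξ public
    using (orbitSum; orbitSum-cong; orbitSum-+; orbitSum-period)
  open OrbitSums A X connected ξ harmonic f aut ξ∘f≈ξ using (base; orbitWalk; walkSum≈orbitSum)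
  open VertexRelation Y using () renaming (~-sym to ~ʸ-sym; ~-trans to ~ʸ-trans; ≡⇒~ to ≡⇒~ʸ)
  open Walks
  private
    module SumX = WalkSums A X ξ
    module SumY = WalkSums A Y ξ̄

  isFlow : IsFlow A Y ξ̄
  isFlow = record
    { antisym   = antisymʸ
    ; generates = λ a → Gen-mono (λ { (x , ξx≈b) → φ x , trans (ξ̄∘φ≈ξ x) ξx≈b }) (generates a)
    }
    where
    open IsFlow (IsHarmonic.flow harmonic)
    antisymʸ : ∀ ȳ → ξ̄ (inv Y ȳ) ≈ ξ̄ ȳ ⁻¹
    antisymʸ ȳ with x , ≡.refl ← surj ȳ = begin
      ξ̄ (inv Y (φ x))   ≡⟨ ≡.cong ξ̄ (inv-comm x) ⟩
      ξ̄ (φ (inv X x))   ≈⟨ ξ̄∘φ≈ξ (inv X x) ⟩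
      ξ (inv X x)       ≈⟨ antisym x ⟩
      ξ x ⁻¹            ≈⟨ ⁻¹-cong (ξ̄∘φ≈ξ x) ⟨
      ξ̄ (φ x) ⁻¹        ∎

  vertexSum≈ε : SemiregularOnVertices X f → ∀ x̄ → vertexSum A Y ξ̄ x̄ ≈ ε
  vertexSum≈ε semiregular x̄ with x , ≡.refl ← surj x̄ =
    trans (vertexSum-φ A {ξ̄ = ξ̄} ξ̄∘φ≈ξ semiregular x) (IsHarmonic.vertexZero harmonic x)

  orbitSum∈LocalGroup : ∀ i → InLocalGroup A Y ξ̄ (orbitSum i)
  orbitSum∈LocalGroup i = Gen-resp (walkSum-mapWalk A φ-isHomomorphism {νH = ξ̄} ξ̄∘φ≈ξ (orbitWalk i))
    (SumY.closedWalk∈LocalGroup (≡⇒~ʸ (≡.sym (φ-iter i base))) (mapWalk φ-isHomomorphism (orbitWalk i)))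

  cycleSums⊆orbitSums : ∀ {a} → (Σ (OrientedCycle Y) λ C → cycleSum A Y ξ̄ C ≈ a) →
                        ∃ λ m → orbitSum m ≈ a
  cycleSums⊆orbitSums {a} (C , cycleSum≈a)
    with x , φx≡d₀ ← surj (OrientedCycle.dart C zero)
    with z , w , φz~dₗ⁻¹ , w≈w̄ ← liftWalk A ξ̄∘φ≈ξ (cycleWalk Y C) x (≡⇒~ʸ φx≡d₀)
    with m , z~fᵐx ← vertex⇒orbit (~ʸ-trans φz~dₗ⁻¹ (~ʸ-trans (~ʸ-sym (OrientedCycle.closed C))
                                                               (≡⇒~ʸ (≡.sym φx≡d₀))))
    = m , (begin
      orbitSum m                      ≈⟨ walkSum≈orbitSum m (respʳ X z~fᵐx w) ⟨
      SumX.walkSum (respʳ X z~fᵐx w)  ≡⟨ SumX.walkSum-respʳ z~fᵐx w ⟩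
      SumX.walkSum w                  ≈⟨ w≈w̄ ⟩
      SumY.walkSum (cycleWalk Y C)    ≈⟨ SumY.walkSum-cycleWalk C ⟩
      cycleSum A Y ξ̄ C                ≈⟨ cycleSum≈a ⟩
      a                               ∎)

lemma4p2 : ∀ {c ℓ} (A : AbelianGroup c ℓ) (X : Graph) → Connected X →
    (ξ : Dart X → AbelianGroup.Carrier A) → IsHarmonic A X ξ →
    (f : Dart X → Dart X) → IsAutomorphism X f →
    (∀ x → AbelianGroup._≈_ A (ξ (f x)) (ξ x)) →
    SemiregularOnDarts X f → SemiregularOnVertices X f →
    (Y : Graph) (φ : Dart X → Dart Y) → IsQuotientBy X f Y φ →
    (ξ̄ : Dart Y → AbelianGroup.Carrier A) →
    (∀ x → AbelianGroup._≈_ A (ξ̄ (φ x)) (ξ x)) →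
    IsFlow A Y ξ̄
      × (∀ x̄ → AbelianGroup._≈_ A (vertexSum A Y ξ̄ x̄) (AbelianGroup.ε A))
      × EpiImageOfCyclic A X f Y ξ̄
lemma4p2 A X connected ξ harmonic f aut ξ∘f≈ξ semiregularᴰ semiregularⱽ Y φ quotient ξ̄ ξ̄∘φ≈ξ
  with N , fᴺ⁺¹≗id ← semiregular⇒finiteOrder X f semiregularᴰ
  = isFlow
  , vertexSum≈ε semiregularⱽ
  , orbitSum , orbitSum-cong , orbitSum-+ , orbitSum∈LocalGroup
  , λ _ → Gen⊆image orbitSum N orbitSum-+ (orbitSum-period (suc N) fᴺ⁺¹≗id) cycleSums⊆orbitSums
  where
  open GeneratedSubgroup A using (Gen⊆image)
  open QuotientFlow A X connected ξ harmonic f aut ξ∘f≈ξ quotient ξ̄ ξ̄∘φ≈ξ
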